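{- Let $D$ be a dictionary over an alphabet of size $s$ with content $\{r_m\}$, and let $q\ge1$ be an integer. Then the complexity of the Fredriksson–Grabowski algorithm $\mathrm{FG}(q)$ satisfies \[ \Phi_{\mathrm{FG}(q)}(D)\le \frac{\ln s}{q}\Bigg(1+\sum_m r_m\sum_{p=0}^{q-1}s^{ -[m/q]_p}\big(m-[m/q]_p\big)\Bigg), \] where $[m/q]_p=\lfloor\frac{m-p-1}{q}\rfloor+1$.
   Context: Let $\Sigma$ be an alphabet of $s$ symbols, $D$ a dictionary (collection of nonempty words over $\Sigma$), with $r_m$ the number of words of length $m$. Texts $\xi\in\Sigma^n$ are uniformly random. For a word $w$ of length $m$ with characters $w^1\cdots w^m$ and $0\le p<q$, the diluted word is $w_{,p}=w^{m-p-hq}\cdots w^{m-p-q}w^{m-p}$ with $h=\lfloor (m-p-1)/q\rfloor$, of length $[m/q]_p$; the diluted dictionary $D^{(q)}$ consists of all $w_{,p}$, $w\in D$, $0\le p<q$, and the diluted text is $\xi^{(q)}=(\xi_q,\xi_{2q},\xi_{3q},\dots)$. The algorithm $\mathrm{FG}(q)$ reads all characters of $\xi^{(q)}$; whenever a diluted word $w_{,p}$ is found in $\xi^{(q)}$, it reads the remaining $|w|-[|w|/q]_p$ characters of the corresponding window of $\xi$ to check whether $w$ occurs there. $\Phi_{\mathrm{FG}(q)}(D)$ denotes $\ln s$ times the limit as $n\to\infty$ of $\frac1n$ times the expected number of character accesses of this algorithm on a uniform text of length $n$ (an upper bound to the optimal complexity $\Phi(D)$, itself defined as $\ln s$ times the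 limiting optimal expected fraction of characters read to solve multiple pattern matching). -}

module Defs where

open import Data.Nat using (ℕ; zero; suc; _+_; _*_; _∸_; _^_; _≤ᵇ_; NonZero)
open import Data.Nat.DivMod using (_/_)
open import Data.Nat.Properties using (m^n≢0; m*n≢0)
open import Data.Bool using (Bool; true; false; if_then_else_; _∧_; T?)
open import Data.Bool.ListAction using (and)
open import Data.Nat.ListAction using (sum)
open import Data.Fin using (Fin)
import Data.Fin as Fin
open import Data.List using (List; []; _∷_; map; concatMap; foldr; length; filter; upTo; applyUpTo; allFin)
import Data.List as List
open import Data.Maybe using (Maybe; just; nothing)
open import Relation.Nullary.Decidable using (⌊_⌋)
open import Data.Integer using (+_)
open import Data.Rational using (ℚ; 0ℚ)
import Data.Rational as ℚ

sumℕ : ℕ → (ℕ → ℕ) → ℕ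
sumℕ k f = sum (map f (upTo k))

sumℚ : ℕ → (ℕ → ℚ) → ℚ
sumℚ k f = foldr ℚ._+_ 0ℚ (map f (upTo k))

frac : ℕ → (d : ℕ) → .{{NonZero d}} → ℚ
frac a d = (+ a) ℚ./ d

wordsOfLength : (s m : ℕ) → List (List (Fin s))
wordsOfLength s zero    = [] ∷ []
wordsOfLength s (suc m) = concatMap (λ c → map (c ∷_) (wordsOfLength s m)) (allFin s)

Dictionary : ℕ → Set
Dictionary s = List (Fin s) → Bool

wordsOfD : ∀ {s} → Dictionary s → ℕ → List (List (Fin s))
wordsOfD {s} D m = filter (λ w → T? (D w)) (wordsOfLength s m)

content : ∀ {s} → Dictionary s → ℕ → ℕ
content D m = length (wordsOfD D m)

-- [m/q]_p = ⌊(m-p-1)/q⌋ + 1 = ⌊(m+q-p-1)/q⌋   (for 0 ≤ p < q)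
dlen : (m q p : ℕ) → .{{NonZero q}} → ℕ
dlen m q p = (m + q ∸ suc p) / q

-- 1-indexed access to a list: nth xs i = x_i (nothing if out of range)
nth : ∀ {A : Set} → List A → ℕ → Maybe A
nth []       _             = nothing
nth (x ∷ xs) zero          = nothing
nth (x ∷ xs) (suc zero)    = just x
nth (x ∷ xs) (suc (suc i)) = nth xs (suc i)

eqM : ∀ {s} → Maybe (Fin s) → Maybe (Fin s) → Bool
eqM (just a) (just b) = ⌊ a Fin.≟ b ⌋
eqM _        _        = false

-- Does the diluted word w_{,p} occur in the diluted text ξ^{(q)} ending at diluted
-- position j (i.e. at text position j*q, aligned with the character w^{m-p}),
-- with the whole window of w (text positions jq-(m-p)+1 .. jq+p) inside ξ?
-- The diluted word is w^{m-p-hq} ... w^{m-p-q} w^{m-p}; its k-th character from the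
-- right, w^{m-p-kq} (k < [m/q]_p), is compared with ξ_{(j-k)q}.
dilutedHit : ∀ {s} (q : ℕ) → .{{NonZero q}} → (ξ : List (Fin s)) → (w : List (Fin s)) → (p j : ℕ) → Bool
dilutedHit q ξ w p j =
  let m = length w in
  ((m ≤ᵇ j * q + p) ∧ (j * q + p ≤ᵇ length ξ))
  ∧ and (map (λ k → eqM (nth ξ ((j ∸ k) * q)) (nth w (m ∸ p ∸ k * q))) (upTo (dlen m q p)))

-- Number of character accesses of FG(q) on the text ξ (counted with multiplicity):
-- all ⌊n/q⌋ characters of ξ^{(q)}, plus, for each occurrence of a diluted word w_{,p}
-- (for every pair (w,p), w ∈ D, 0 ≤ p < q) ending at a position j of ξ^{(q)}, the
-- remaining |w| - [|w|/q]_p characters of the window.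
-- (Only words of length ≤ n = |ξ| can fit, so the sum over D is restricted to them.)
costFG : ∀ {s} → Dictionary s → (q : ℕ) → .{{NonZero q}} → List (Fin s) → ℕ
costFG D q ξ =
  let n = length ξ in
  n / q
  + sumℕ (n / q) (λ j′ →
      sumℕ (suc n) (λ m →
        sum (map (λ w →
          sumℕ q (λ p → if dilutedHit q ξ w p (suc j′) then m ∸ dlen m q p else 0))
          (wordsOfD D m))))

totalCostFG : ∀ {s} → Dictionary s → (q : ℕ) → .{{NonZero q}} → ℕ → ℕ
totalCostFG {s} D q n = sum (map (costFG D q) (wordsOfLength s n))

-- (1/n) · E[accesses] on a uniform random text of length n ≥ 1:
--   totalCost / (n · s^n)
avgCostFG : ∀ {s} .{{_ : NonZero s}} → Dictionary s → (q : ℕ) → .{{NonZero q}} → (n : ℕ) → .{{NonZero n}} → ℚ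
avgCostFG {s} {{sz}} D q n {{nz}} = frac (totalCostFG D q n) (n * s ^ n) {{m*n≢0 n (s ^ n) {{nz}} {{m^n≢0 s n {{sz}}}}}}

-- Partial sums of the right-hand bracket (without ln s):
--   (1/q) (1 + Σ_{m=0}^{M} r_m Σ_{p=0}^{q-1} s^{-[m/q]_p} (m - [m/q]_p))
boundFG : ∀ {s} .{{_ : NonZero s}} → Dictionary s → (q : ℕ) → .{{NonZero q}} → ℕ → ℚ
boundFG {s} D q M =
  frac 1 q ℚ.* (frac 1 1 ℚ.+
    sumℚ (suc M) (λ m →
      frac (content D m) 1 ℚ.*
        sumℚ q (λ p → frac (m ∸ dlen m q p) (s ^ dlen m q p) {{m^n≢0 s (dlen m q p)}})))

module Submission where

-- The bound holds non-asymptotically: for every text length n ≥ 1,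
--   avgCostFG D q n ≤ boundFG D q n,
-- so the limit statement follows with the threshold N = 0 and M = n.
--
-- On a text ξ, FG(q) reads ⌊n/q⌋ characters of the diluted text and, for each
-- diluted position j and each pair (w , p) with w_{,p} occurring at j, another
-- m − [m/q]_p characters (m = |w|).  An occurrence of w_{,p} at j prescribes
-- the letters of ξ at the [m/q]_p distinct positions (j − k) q, so at most
-- s^(n − [m/q]_p) of the s^n texts contain it (module AccessCount, via a
-- general counting lemma for texts satisfying apart letter constraints).
-- Summing over j, m, w, p gives the bound in ℕ
--   totalCostFG ≤ s^n ⌊n/q⌋ + ⌊n/q⌋ C,   C = Σ_{m ≤ n} r_m Σ_p (m − [m/q]_p) s^(n − [m/q]_p).

module AccessCount where

  open import Defs
  open import Data.Nat using (ℕ; zero; suc; _+_; _*_; _∸_; _^_; _≤_; _<_; _≤?_; z≤n; NonZero)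
  open import Data.Nat.Properties
  open import Data.Nat.DivMod using (_/_)
  open import Data.Bool using (Bool; true; false; _∧_; if_then_else_; T?)
  open import Data.Bool.Properties using (∧-zeroʳ; ∧-assoc)
  open import Data.Bool.ListAction using (and)
  open import Data.Nat.ListAction using (sum)
  open import Data.Nat.ListAction.Properties using (sum-++)
  open import Data.Fin using (Fin)
  import Data.Fin as Fin
  open import Data.List using (List; []; _∷_; map; concatMap; length; upTo; allFin)
  open import Data.List.Properties using (map-++; map-∘; map-cong; map-cong-local; length-map; length-upTo; length-tabulate; map-tabulate)
  open import Data.List.Relation.Unary.All as All using (All; []; _∷_)
  import Data.List.Relation.Unary.All.Properties as AllP
  open import Data.List.Relation.Unary.AllPairs using (AllPairs; []; _∷_)
  import Data.List.Relation.Unary.AllPairs.Properties as AllPairsP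
  open import Data.Maybe using (Maybe; just; nothing)
  open import Data.Product using (_×_; _,_)
  open import Data.Sum using (_⊎_; inj₁; inj₂)
  open import Relation.Nullary using (yes; no)
  open import Relation.Binary.PropositionalEquality
  open import Data.Nat.Tactic.RingSolver using (solve-∀)
  open import Function using (id; _∘_)

  𝟙 : Bool → ℕ
  𝟙 true  = 1
  𝟙 false = 0

  𝟙-∧ : ∀ a b → 𝟙 (a ∧ b) ≡ 𝟙 a * 𝟙 b
  𝟙-∧ true  b = sym (+-identityʳ (𝟙 b))
  𝟙-∧ false b = refl

  𝟙-∧-≤ˡ : ∀ a b → 𝟙 (a ∧ b) ≤ 𝟙 a
  𝟙-∧-≤ˡ true  true  = ≤-refl
  𝟙-∧-≤ˡ true  false = z≤n
  𝟙-∧-≤ˡ false b     = z≤n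

  𝟙-∧-≤ʳ : ∀ a b → 𝟙 (a ∧ b) ≤ 𝟙 b
  𝟙-∧-≤ʳ true  b = ≤-refl
  𝟙-∧-≤ʳ false b = z≤n

  if-then-0 : ∀ b x → (if b then x else 0) ≡ x * 𝟙 b
  if-then-0 true  x = sym (*-identityʳ x)
  if-then-0 false x = sym (*-zeroʳ x)

  module _ {A : Set} where

    sum-cong : ∀ {f g : A → ℕ} xs → (∀ x → f x ≡ g x) → sum (map f xs) ≡ sum (map g xs)
    sum-cong xs f≡g = cong sum (map-cong f≡g xs)

    sum-cong-All : ∀ {P : A → Set} {f g : A → ℕ} xs → All P xs → (∀ x → P x → f x ≡ g x) →
                   sum (map f xs) ≡ sum (map g xs)
    sum-cong-All xs Pxs f≡g = cong sum (map-cong-local (All.map (λ {x} → f≡g x) Pxs))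

    sum-mono : ∀ {f g : A → ℕ} xs → (∀ x → f x ≤ g x) → sum (map f xs) ≤ sum (map g xs)
    sum-mono []       f≤g = z≤n
    sum-mono (x ∷ xs) f≤g = +-mono-≤ (f≤g x) (sum-mono xs f≤g)

    sum-*ˡ : ∀ a (f : A → ℕ) xs → sum (map (λ x → a * f x) xs) ≡ a * sum (map f xs)
    sum-*ˡ a f []       = sym (*-zeroʳ a)
    sum-*ˡ a f (x ∷ xs) = trans (cong (a * f x +_) (sum-*ˡ a f xs)) (sym (*-distribˡ-+ a (f x) _))

    sum-*ʳ : ∀ a (f : A → ℕ) xs → sum (map (λ x → f x * a) xs) ≡ sum (map f xs) * a
    sum-*ʳ a f []       = refl
    sum-*ʳ a f (x ∷ xs) = trans (cong (f x * a +_) (sum-*ʳ a f xs)) (sym (*-distribʳ-+ a (f x) _))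

    sum-+ : ∀ (f g : A → ℕ) xs → sum (map (λ x → f x + g x) xs) ≡ sum (map f xs) + sum (map g xs)
    sum-+ f g []       = refl
    sum-+ f g (x ∷ xs) = trans (cong (f x + g x +_) (sum-+ f g xs)) (interchange (f x) (g x) _ _)
      where
      interchange : ∀ a b c d → a + b + (c + d) ≡ a + c + (b + d)
      interchange = solve-∀

    sum-const : ∀ a (xs : List A) → sum (map (λ _ → a) xs) ≡ length xs * a
    sum-const a []       = refl
    sum-const a (x ∷ xs) = cong (a +_) (sum-const a xs)

    sum-zero : ∀ (f : A → ℕ) xs → (∀ x → f x ≡ 0) → sum (map f xs) ≡ 0
    sum-zero f xs f≡0 = trans (sum-cong xs f≡0) (trans (sum-const 0 xs) (*-zeroʳ (length xs)))

    sum-concatMap : ∀ {B : Set} (f : B → ℕ) (g : A → List B) xs →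
                    sum (map f (concatMap g xs)) ≡ sum (map (λ x → sum (map f (g x))) xs)
    sum-concatMap f g []       = refl
    sum-concatMap f g (x ∷ xs) =
      trans (cong sum (map-++ f (g x) (concatMap g xs)))
        (trans (sum-++ (map f (g x)) _) (cong (sum (map f (g x)) +_) (sum-concatMap f g xs)))

  sum-swap : ∀ {A B : Set} (f : A → B → ℕ) xs ys →
    sum (map (λ x → sum (map (f x) ys)) xs) ≡ sum (map (λ y → sum (map (λ x → f x y) xs)) ys)
  sum-swap f []       ys = sym (sum-zero _ ys (λ _ → refl))
  sum-swap f (x ∷ xs) ys =
    trans (cong (sum (map (f x) ys) +_) (sum-swap f xs ys))
      (sym (sum-+ (f x) (λ y → sum (map (λ x → f x y) xs)) ys))

  letter-matches≤1 : ∀ {k} (mc : Maybe (Fin k)) → sum (map (λ c → 𝟙 (eqM (just c) mc)) (allFin k)) ≤ 1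
  letter-matches≤1 {k} nothing = ≤-trans (≤-reflexive (sum-zero (λ c → 𝟙 (eqM (just c) nothing)) (allFin k) (λ _ → refl))) z≤n
  letter-matches≤1     (just a) = go a
    where
    sum-allFin-suc : ∀ {k} (f : Fin (suc k) → ℕ) →
      sum (map f (allFin (suc k))) ≡ f Fin.zero + sum (map (f ∘ Fin.suc) (allFin k))
    sum-allFin-suc {k} f = cong (λ xs → f Fin.zero + sum xs)
      (trans (map-tabulate Fin.suc f) (sym (map-tabulate id (f ∘ Fin.suc))))

    suc-≟ : ∀ {k} (c a : Fin k) → eqM (just (Fin.suc c)) (just (Fin.suc a)) ≡ eqM (just c) (just a)
    suc-≟ c a with c Fin.≟ a
    ... | yes _ = refl
    ... | no  _ = refl

    go : ∀ {k} (a : Fin k) → sum (map (λ c → 𝟙 (eqM (just c) (just a))) (allFin k)) ≤ 1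
    go {suc k} Fin.zero = ≤-reflexive (trans (sum-allFin-suc {k} (λ c → 𝟙 (eqM (just c) (just Fin.zero))))
      (cong suc (sum-zero (λ c → 𝟙 (eqM (just (Fin.suc c)) (just Fin.zero))) (allFin k) (λ _ → refl))))
    go {suc k} (Fin.suc a) = ≤-trans
      (≤-reflexive (trans (sum-allFin-suc {k} (λ c → 𝟙 (eqM (just c) (just (Fin.suc a)))))
                          (sum-cong (allFin k) (λ c → cong 𝟙 (suc-≟ c a)))))
      (go a)

  wordsOfLength-length : ∀ s n → All (λ ξ → length ξ ≡ n) (wordsOfLength s n)
  wordsOfLength-length s zero    = refl ∷ []
  wordsOfLength-length s (suc n) = AllP.concat⁺ (AllP.map⁺
    (All.universal (λ c → AllP.map⁺ (All.map (cong suc) (wordsOfLength-length s n))) (allFin s)))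

  wordsOfD-length : ∀ {s} (D : Dictionary s) m → All (λ w → length w ≡ m) (wordsOfD D m)
  wordsOfD-length {s} D m = AllP.filter⁺ (λ w → T? (D w)) (wordsOfLength-length s m)

  -- c s^d ≤ s^n gives c ≤ s^(n ∸ d), also when d > n (then c = 0 ≤ 1).
  cancel-power : ∀ s .{{_ : NonZero s}} c d n → c * s ^ d ≤ s ^ n → c ≤ s ^ (n ∸ d)
  cancel-power s c d n c*sᵈ≤sⁿ with d ≤? n
  ... | yes d≤n = *-cancelʳ-≤ c (s ^ (n ∸ d)) (s ^ d) {{m^n≢0 s d}}
        (≤-trans c*sᵈ≤sⁿ (≤-reflexive (trans (cong (s ^_) (sym (m∸n+n≡m d≤n))) (^-distribˡ-+-* s (n ∸ d) d))))
  ... | no  d≰n rewrite m≤n⇒m∸n≡0 (<⇒≤ (≰⇒> d≰n)) = *-cancelʳ-≤ c 1 (s ^ d) {{m^n≢0 s d}}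
        (≤-trans c*sᵈ≤sⁿ (≤-trans (^-monoʳ-≤ s (<⇒≤ (≰⇒> d≰n))) (≤-reflexive (sym (*-identityˡ _)))))

  module TextCounting (s : ℕ) where

    -- (i , c) demands that the i-th letter (1-indexed) of the text be c;
    -- position 0 and the letter `nothing` are never matched.
    Constraint : Set
    Constraint = ℕ × Maybe (Fin s)

    holds : List (Fin s) → Constraint → Bool
    holds ξ (i , mc) = eqM (nth ξ i) mc

    holdsAll : List Constraint → List (Fin s) → Bool
    holdsAll cs ξ = and (map (holds ξ) cs)

    -- Constraints at distinct positions (repetitions at the unsatisfiable position 0 are harmless).
    Apart : Constraint → Constraint → Set
    Apart (i , _) (j , _) = i ≡ 0 ⊎ i ≢ j

    count : ℕ → List Constraint → ℕ
    count n cs = sum (map (λ ξ → 𝟙 (holdsAll cs ξ)) (wordsOfLength s n))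

    firstOK : Fin s → List Constraint → Bool
    firstOK c []                         = true
    firstOK c ((zero , mc) ∷ cs)         = firstOK c cs
    firstOK c ((suc zero , mc) ∷ cs)     = eqM (just c) mc ∧ firstOK c cs
    firstOK c ((suc (suc i) , mc) ∷ cs)  = firstOK c cs

    shift : List Constraint → List Constraint
    shift []                        = []
    shift ((zero , mc) ∷ cs)        = (zero , mc) ∷ shift cs
    shift ((suc zero , mc) ∷ cs)    = shift cs
    shift ((suc (suc i) , mc) ∷ cs) = (suc i , mc) ∷ shift cs

    atFirst : List Constraint → ℕ
    atFirst []                        = 0
    atFirst ((zero , mc) ∷ cs)        = atFirst cs
    atFirst ((suc zero , mc) ∷ cs)    = suc (atFirst cs)
    atFirst ((suc (suc i) , mc) ∷ cs) = atFirst cs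

    holdsAll-∷ : ∀ cs c ξ → holdsAll cs (c ∷ ξ) ≡ firstOK c cs ∧ holdsAll (shift cs) ξ
    holdsAll-∷ []                        c ξ = refl
    holdsAll-∷ ((zero , mc) ∷ cs)        c ξ = sym (trans (cong (λ b → firstOK c cs ∧ (b ∧ holdsAll (shift cs) ξ))
                                                              (never-at-0 ξ))
                                                        (∧-zeroʳ (firstOK c cs)))
      where
      never-at-0 : ∀ ξ → eqM (nth ξ 0) mc ≡ false
      never-at-0 []      = refl
      never-at-0 (_ ∷ _) = refl
    holdsAll-∷ ((suc zero , mc) ∷ cs)    c ξ rewrite holdsAll-∷ cs c ξ = sym (∧-assoc (eqM (just c) mc) (firstOK c cs) _)
    holdsAll-∷ ((suc (suc i) , mc) ∷ cs) c ξ rewrite holdsAll-∷ cs c ξ = swap-∧ (eqM (nth ξ (suc i)) mc) (firstOK c cs) _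
      where
      swap-∧ : ∀ a b c → a ∧ (b ∧ c) ≡ b ∧ (a ∧ c)
      swap-∧ true  b c     = refl
      swap-∧ false true  c = refl
      swap-∧ false false c = refl

    length-shift : ∀ cs → length cs ≡ atFirst cs + length (shift cs)
    length-shift []                        = refl
    length-shift ((zero , mc) ∷ cs)        = trans (cong suc (length-shift cs)) (sym (+-suc (atFirst cs) _))
    length-shift ((suc zero , mc) ∷ cs)    = cong suc (length-shift cs)
    length-shift ((suc (suc i) , mc) ∷ cs) = trans (cong suc (length-shift cs)) (sym (+-suc (atFirst cs) _))

    firstChoices : List Constraint → ℕ
    firstChoices cs = sum (map (λ c → 𝟙 (firstOK c cs)) (allFin s))

    count-suc : ∀ n cs → count (suc n) cs ≡ firstChoices cs * count n (shift cs)
    count-suc n cs =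
      begin
        count (suc n) cs
      ≡⟨ sum-concatMap (λ ξ → 𝟙 (holdsAll cs ξ)) (λ c → map (c ∷_) (wordsOfLength s n)) (allFin s) ⟩
        sum (map (λ c → sum (map (λ ξ → 𝟙 (holdsAll cs ξ)) (map (c ∷_) (wordsOfLength s n)))) (allFin s))
      ≡⟨ sum-cong (allFin s) (λ c → trans (cong sum (sym (map-∘ (wordsOfLength s n))))
           (trans (sum-cong (wordsOfLength s n) (λ ξ → trans (cong 𝟙 (holdsAll-∷ cs c ξ)) (𝟙-∧ (firstOK c cs) _)))
                  (sum-*ˡ (𝟙 (firstOK c cs)) (λ ξ → 𝟙 (holdsAll (shift cs) ξ)) (wordsOfLength s n)))) ⟩
        sum (map (λ c → 𝟙 (firstOK c cs) * count n (shift cs)) (allFin s))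
      ≡⟨ sum-*ʳ (count n (shift cs)) (λ c → 𝟙 (firstOK c cs)) (allFin s) ⟩
        firstChoices cs * count n (shift cs)
      ∎
      where open ≡-Reasoning

    shift-apart : ∀ cs → AllPairs Apart cs → AllPairs Apart (shift cs)
    shift-apart [] [] = []
    shift-apart ((zero , mc) ∷ cs)        (_ ∷ ap) = All.universal (λ _ → inj₁ refl) (shift cs) ∷ shift-apart cs ap
    shift-apart ((suc zero , mc) ∷ cs)    (_ ∷ ap) = shift-apart cs ap
    shift-apart ((suc (suc i) , mc) ∷ cs) (a ∷ ap) = head-apart cs a ∷ shift-apart cs ap
      where
      head-apart : ∀ cs → All (Apart (suc (suc i) , mc)) cs → All (Apart (suc i , mc)) (shift cs)
      head-apart []                         []              = []
      head-apart ((zero , _) ∷ cs)          (_ ∷ a)         = inj₂ (λ ()) ∷ head-apart cs a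
      head-apart ((suc zero , _) ∷ cs)      (_ ∷ a)         = head-apart cs a
      head-apart ((suc (suc j) , _) ∷ cs)   (inj₂ i≢j ∷ a)  = inj₂ (i≢j ∘ cong suc) ∷ head-apart cs a

    none-atFirst : ∀ mc cs → All (Apart (1 , mc)) cs → atFirst cs ≡ 0
    none-atFirst mc []                       []             = refl
    none-atFirst mc ((zero , _) ∷ cs)        (_ ∷ a)        = none-atFirst mc cs a
    none-atFirst mc ((suc zero , _) ∷ cs)    (inj₂ 1≢1 ∷ a) with 1≢1 refl
    ... | ()
    none-atFirst mc ((suc (suc i) , _) ∷ cs) (_ ∷ a)        = none-atFirst mc cs a

    -- Apart constraints fix at most one letter at position 1: the first letter
    -- has s choices if unconstrained and at most one otherwise.
    firstChoices-bound : ∀ cs → AllPairs Apart cs → firstChoices cs * s ^ atFirst cs ≤ s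
    firstChoices-bound [] [] = ≤-reflexive (trans (*-identityʳ _)
      (trans (sum-const 1 (allFin s)) (trans (*-identityʳ _) (length-tabulate id))))
    firstChoices-bound ((zero , mc) ∷ cs)        (_ ∷ ap) = firstChoices-bound cs ap
    firstChoices-bound ((suc (suc i) , mc) ∷ cs) (_ ∷ ap) = firstChoices-bound cs ap
    firstChoices-bound ((suc zero , mc) ∷ cs)    (a ∷ ap) rewrite none-atFirst mc cs a =
      ≤-trans (*-monoˡ-≤ (s * 1) (≤-trans (sum-mono (allFin s) (λ c → 𝟙-∧-≤ˡ (eqM (just c) mc) (firstOK c cs)))
                                          (letter-matches≤1 mc)))
              (≤-reflexive (trans (*-identityˡ (s * 1)) (*-identityʳ s)))

    count-bound : ∀ n cs → AllPairs Apart cs → count n cs * s ^ length cs ≤ s ^ n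
    count-bound zero    []             ap = ≤-refl
    count-bound zero    (_ ∷ cs)       ap = z≤n
    count-bound (suc n) cs             ap =
      begin
        count (suc n) cs * s ^ length cs
      ≡⟨ cong₂ _*_ (count-suc n cs) (trans (cong (s ^_) (length-shift cs)) (^-distribˡ-+-* s (atFirst cs) _)) ⟩
        (firstChoices cs * count n (shift cs)) * (s ^ atFirst cs * s ^ length (shift cs))
      ≡⟨ [m*n]*[o*p]≡[m*o]*[n*p] (firstChoices cs) _ _ _ ⟩
        (firstChoices cs * s ^ atFirst cs) * (count n (shift cs) * s ^ length (shift cs))
      ≤⟨ *-mono-≤ (firstChoices-bound cs ap) (count-bound n (shift cs) (shift-apart cs ap)) ⟩
        s * s ^ n
      ∎
      where open ≤-Reasoning

    texts-bound : ∀ n → length (wordsOfLength s n) ≤ s ^ n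
    texts-bound n = ≤-trans (≤-reflexive (trans (sym (*-identityʳ _)) (sym (sum-const 1 (wordsOfLength s n)))))
                            (≤-trans (≤-reflexive (sym (*-identityʳ _))) (count-bound n [] []))

  -- An occurrence of a diluted word w_{,p} ending at diluted position J is a
  -- set of [m/q]_p apart constraints on the text.
  module DilutedHits (s : ℕ) .{{_ : NonZero s}} (q : ℕ) .{{_ : NonZero q}} where
    open TextCounting s

    hitConstraints : List (Fin s) → ℕ → ℕ → List Constraint
    hitConstraints w p J = map (λ k → ((J ∸ k) * q , nth w (length w ∸ p ∸ k * q))) (upTo (dlen (length w) q p))

    hit⇒holdsAll : ∀ ξ w p J → 𝟙 (dilutedHit q ξ w p J) ≤ 𝟙 (holdsAll (hitConstraints w p J) ξ)
    hit⇒holdsAll ξ w p J = ≤-trans (𝟙-∧-≤ʳ _ _) (≤-reflexive (cong 𝟙 (cong and (map-∘ (upTo (dlen (length w) q p))))))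

    positions-apart : ∀ J i j → i < j → (J ∸ i) * q ≡ 0 ⊎ (J ∸ i) * q ≢ (J ∸ j) * q
    positions-apart J i j i<j with J ≤? i
    ... | yes J≤i = inj₁ (cong (_* q) (m≤n⇒m∸n≡0 J≤i))
    ... | no  J≰i = inj₂ (λ eq → <-irrefl (sym (*-cancelʳ-≡ (J ∸ i) (J ∸ j) q eq)) J∸j<J∸i)
      where
      J∸j<J∸i : J ∸ j < J ∸ i
      J∸j<J∸i = ≤-<-trans (∸-monoʳ-≤ J i<j) (∸-monoʳ-< (n<1+n i) (≰⇒> J≰i))

    hitConstraints-apart : ∀ w p J → AllPairs Apart (hitConstraints w p J)
    hitConstraints-apart w p J =
      AllPairsP.map⁺ (AllPairsP.applyUpTo⁺₁ id (dlen (length w) q p) (λ {i} {j} i<j _ → positions-apart J i j i<j))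

    length-hitConstraints : ∀ w p J → length (hitConstraints w p J) ≡ dlen (length w) q p
    length-hitConstraints w p J = trans (length-map _ (upTo (dlen (length w) q p))) (length-upTo _)

    hit-count : ∀ n w p J → sum (map (λ ξ → 𝟙 (dilutedHit q ξ w p J)) (wordsOfLength s n))
                            ≤ s ^ (n ∸ dlen (length w) q p)
    hit-count n w p J = ≤-trans (sum-mono (wordsOfLength s n) (λ ξ → hit⇒holdsAll ξ w p J))
      (cancel-power s (count n cs) (dlen (length w) q p) n
        (subst (λ k → count n cs * s ^ k ≤ s ^ n) (length-hitConstraints w p J) (count-bound n cs (hitConstraints-apart w p J))))
      where cs = hitConstraints w p J

  module TotalCost (s : ℕ) .{{_ : NonZero s}} (D : Dictionary s) (q : ℕ) .{{_ : NonZero q}} where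
    open TextCounting s using (texts-bound)
    open DilutedHits s q

    -- Expected verification cost per text and diluted position, scaled by s^n:
    --   C n = Σ_{m ≤ n} r_m Σ_{p < q} (m − [m/q]_p) s^(n − [m/q]_p).
    weightedCost : ℕ → ℕ → ℕ
    weightedCost n m = sumℕ q (λ p → (m ∸ dlen m q p) * s ^ (n ∸ dlen m q p))

    C : ℕ → ℕ
    C n = sumℕ (suc n) (λ m → content D m * weightedCost n m)

    verifyCost : ℕ → List (Fin s) → ℕ → ℕ
    verifyCost n ξ j′ = sumℕ (suc n) (λ m → sum (map (λ w →
      sumℕ q (λ p → (m ∸ dlen m q p) * 𝟙 (dilutedHit q ξ w p (suc j′)))) (wordsOfD D m)))

    costFG-split : ∀ ξ → costFG D q ξ ≡ length ξ / q + sumℕ (length ξ / q) (verifyCost (length ξ) ξ)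
    costFG-split ξ = cong (length ξ / q +_)
      (sum-cong (upTo (length ξ / q)) λ j′ → sum-cong (upTo (suc (length ξ))) λ m → sum-cong (wordsOfD D m) λ w →
         sum-cong (upTo q) λ p → if-then-0 (dilutedHit q ξ w p (suc j′)) (m ∸ dlen m q p))

    words-verifyCost : ∀ n j′ m →
      sum (map (λ ξ → sum (map (λ w → sumℕ q (λ p → (m ∸ dlen m q p) * 𝟙 (dilutedHit q ξ w p (suc j′))))
                               (wordsOfD D m))) (wordsOfLength s n))
      ≤ content D m * weightedCost n m
    words-verifyCost n j′ m =
      begin
        sum (map (λ ξ → sum (map (λ w → sumℕ q (hit w ξ)) (wordsOfD D m))) (wordsOfLength s n))
      ≡⟨ sum-swap (λ ξ w → sumℕ q (hit w ξ)) (wordsOfLength s n) (wordsOfD D m) ⟩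
        sum (map (λ w → sum (map (λ ξ → sumℕ q (hit w ξ)) (wordsOfLength s n))) (wordsOfD D m))
      ≤⟨ sum-mono (wordsOfD D m) (λ w → ≤-trans (≤-reflexive (sum-swap (λ ξ → hit w ξ) (wordsOfLength s n) (upTo q)))
           (sum-mono (upTo q) (λ p → ≤-trans (≤-reflexive (sum-*ˡ (m ∸ dlen m q p) _ (wordsOfLength s n)))
              (*-monoʳ-≤ (m ∸ dlen m q p) (hit-count n w p (suc j′)))))) ⟩
        sum (map (λ w → sumℕ q (λ p → (m ∸ dlen m q p) * s ^ (n ∸ dlen (length w) q p))) (wordsOfD D m))
      ≡⟨ sum-cong-All (wordsOfD D m) (wordsOfD-length D m)
           (λ w |w|≡m → cong (λ l → sumℕ q (λ p → (m ∸ dlen m q p) * s ^ (n ∸ dlen l q p))) |w|≡m) ⟩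
        sum (map (λ _ → weightedCost n m) (wordsOfD D m))
      ≡⟨ sum-const (weightedCost n m) (wordsOfD D m) ⟩
        content D m * weightedCost n m
      ∎
      where
      open ≤-Reasoning
      hit : List (Fin s) → List (Fin s) → ℕ → ℕ
      hit w ξ p = (m ∸ dlen m q p) * 𝟙 (dilutedHit q ξ w p (suc j′))

    verifyCost-total : ∀ n → sum (map (λ ξ → sumℕ (n / q) (verifyCost n ξ)) (wordsOfLength s n)) ≤ (n / q) * C n
    verifyCost-total n =
      begin
        sum (map (λ ξ → sumℕ (n / q) (verifyCost n ξ)) (wordsOfLength s n))
      ≡⟨ sum-swap (verifyCost n) (wordsOfLength s n) (upTo (n / q)) ⟩
        sum (map (λ j′ → sum (map (λ ξ → verifyCost n ξ j′) (wordsOfLength s n))) (upTo (n / q)))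
      ≤⟨ sum-mono (upTo (n / q)) (λ j′ → ≤-trans (≤-reflexive (sum-swap _ (wordsOfLength s n) (upTo (suc n))))
            (sum-mono (upTo (suc n)) (words-verifyCost n j′))) ⟩
        sum (map (λ _ → C n) (upTo (n / q)))
      ≡⟨ trans (sum-const (C n) (upTo (n / q))) (cong (_* C n) (length-upTo (n / q))) ⟩
        (n / q) * C n
      ∎
      where open ≤-Reasoning

    totalCost-bound : ∀ n → totalCostFG D q n ≤ s ^ n * (n / q) + (n / q) * C n
    totalCost-bound n =
      begin
        totalCostFG D q n
      ≡⟨ sum-cong-All (wordsOfLength s n) (wordsOfLength-length s n)
           (λ ξ |ξ|≡n → trans (costFG-split ξ) (cong (λ l → l / q + sumℕ (l / q) (verifyCost l ξ)) |ξ|≡n)) ⟩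
        sum (map (λ ξ → n / q + sumℕ (n / q) (verifyCost n ξ)) (wordsOfLength s n))
      ≡⟨ sum-+ (λ _ → n / q) _ (wordsOfLength s n) ⟩
        sum (map (λ _ → n / q) (wordsOfLength s n)) + sum (map (λ ξ → sumℕ (n / q) (verifyCost n ξ)) (wordsOfLength s n))
      ≤⟨ +-mono-≤ (≤-trans (≤-reflexive (sum-const _ (wordsOfLength s n))) (*-monoˡ-≤ (n / q) (texts-bound n)))
                  (verifyCost-total n) ⟩
        s ^ n * (n / q) + (n / q) * C n
      ∎
      where open ≤-Reasoning

-- Rational numbers with natural numerator and denominator, compared through
-- the unnormalised rationals, where such fractions are directly computable.
module Fractions where

  open import Defs using (frac)
  open import Data.Nat as ℕ using (ℕ; suc; NonZero)
  open import Data.Nat.Properties using (m*n≢0)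
  open import Data.Nat.ListAction using (sum)
  open import Data.Integer as ℤ using (+_; +≤+)
  open import Data.Integer.Properties using (pos-*; pos-+)
  open import Data.Rational using (ℚ; 0ℚ; toℚᵘ)
  import Data.Rational as ℚ
  open import Data.Rational.Properties using (toℚᵘ-fromℚᵘ; toℚᵘ-homo-+)
  open import Data.Rational.Unnormalised as U using (ℚᵘ; mkℚᵘ; _≃_; *≡*; *≤*)
  import Data.Rational.Unnormalised.Properties as UP
  open import Data.List using ([]; _∷_; map; foldr)
  open import Data.List.Relation.Unary.All using (All; []; _∷_)
  open import Relation.Binary.PropositionalEquality
  open import Data.Nat.Tactic.RingSolver using (solve-∀)

  ratio : ℕ → (d : ℕ) → .{{NonZero d}} → ℚᵘ
  ratio a d = (+ a) U./ d

  frac-ratio : ∀ a d .{{_ : NonZero d}} → toℚᵘ (frac a d) ≃ ratio a d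
  frac-ratio a (suc d) = toℚᵘ-fromℚᵘ (mkℚᵘ (+ a) d)

  ratio-≃ : ∀ a d b e .{{_ : NonZero d}} .{{_ : NonZero e}} → a ℕ.* e ≡ b ℕ.* d → ratio a d ≃ ratio b e
  ratio-≃ a (suc d) b (suc e) ae≡bd = *≡* (trans (sym (pos-* a (suc e))) (trans (cong +_ ae≡bd) (pos-* b (suc d))))

  ratio-≤ : ∀ a d b e .{{_ : NonZero d}} .{{_ : NonZero e}} → a ℕ.* e ℕ.≤ b ℕ.* d → ratio a d U.≤ ratio b e
  ratio-≤ a (suc d) b (suc e) ae≤bd = *≤* (subst₂ ℤ._≤_ (pos-* a (suc e)) (pos-* b (suc d)) (+≤+ ae≤bd))

  ratio-+ : ∀ a d b e .{{_ : NonZero d}} .{{_ : NonZero e}} → ratio a d U.+ ratio b e ≃ ratio (a ℕ.* e ℕ.+ b ℕ.* d) (d ℕ.* e) {{m*n≢0 d e}}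
  ratio-+ a (suc d) b (suc e) = *≡* (cong (ℤ._* (+ (suc d ℕ.* suc e)))
    (sym (trans (pos-+ (a ℕ.* suc e) (b ℕ.* suc d)) (cong₂ ℤ._+_ (pos-* a (suc e)) (pos-* b (suc d))))))

  ratio-* : ∀ a d b e .{{_ : NonZero d}} .{{_ : NonZero e}} → ratio a d U.* ratio b e ≃ ratio (a ℕ.* b) (d ℕ.* e) {{m*n≢0 d e}}
  ratio-* a (suc d) b (suc e) = *≡* (cong (ℤ._* (+ (suc d ℕ.* suc e))) (sym (pos-* a b)))

  ratio-+-common : ∀ a b N .{{_ : NonZero N}} → ratio a N U.+ ratio b N ≃ ratio (a ℕ.+ b) N
  ratio-+-common a b N = UP.≃-trans (ratio-+ a N b N) (ratio-≃ _ (N ℕ.* N) (a ℕ.+ b) N {{m*n≢0 N N}} (distrib a b N))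
    where
    distrib : ∀ a b c → (a ℕ.* c ℕ.+ b ℕ.* c) ℕ.* c ≡ (a ℕ.+ b) ℕ.* (c ℕ.* c)
    distrib = solve-∀

  sum-ratio : ∀ {A : Set} (f : A → ℚ) (h : A → ℕ) N .{{_ : NonZero N}} xs →
    All (λ x → toℚᵘ (f x) ≃ ratio (h x) N) xs → toℚᵘ (foldr ℚ._+_ 0ℚ (map f xs)) ≃ ratio (sum (map h xs)) N
  sum-ratio f h N [] [] = UP.≃-trans (frac-ratio 0 1) (ratio-≃ 0 1 0 N refl)
  sum-ratio f h N (x ∷ xs) (fx≃ ∷ fxs≃) =
    begin
      toℚᵘ (f x ℚ.+ foldr ℚ._+_ 0ℚ (map f xs))
    ≈⟨ toℚᵘ-homo-+ (f x) _ ⟩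
      toℚᵘ (f x) U.+ toℚᵘ (foldr ℚ._+_ 0ℚ (map f xs))
    ≈⟨ UP.+-cong fx≃ (sum-ratio f h N xs fxs≃) ⟩
      ratio (h x) N U.+ ratio (sum (map h xs)) N
    ≈⟨ ratio-+-common (h x) _ N ⟩
      ratio (sum (map h (x ∷ xs))) N
    ∎
    where open UP.≃-Reasoning

module AverageCost where

  open import Defs
  open AccessCount using (module TotalCost)
  open Fractions
  open import Data.Nat as ℕ using (ℕ; suc; _+_; _*_; _∸_; _^_; _≤_; s≤s; NonZero)
  open import Data.Nat.Properties
  open import Data.Nat.DivMod using (_/_; m/n*n≤m; m<n*o⇒m/o<n)
  import Data.Rational as ℚ
  open import Data.Rational using (toℚᵘ)
  open import Data.Rational.Properties using (toℚᵘ-homo-+; toℚᵘ-homo-*; toℚᵘ-cancel-≤)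
  open import Data.Rational.Unnormalised as U using (_≃_)
  import Data.Rational.Unnormalised.Properties as UP
  open import Data.List using (upTo)
  import Data.List.Relation.Unary.All as All
  import Data.List.Relation.Unary.All.Properties as AllP
  open import Relation.Binary.PropositionalEquality
  open import Data.Nat.Tactic.RingSolver using (solve-∀)
  open import Function using (id)

  dlen-≤ : ∀ m q p .{{_ : NonZero q}} → dlen m q p ≤ m
  dlen-≤ m (suc q) p = ≤-pred (m<n*o⇒m/o<n (s≤s numerator-bound))
    where
    numerator-bound : m + suc q ∸ suc p ≤ q + m * suc q
    numerator-bound = begin
      m + suc q ∸ suc p  ≡⟨ cong (_∸ suc p) (+-suc m q) ⟩
      m + q ∸ p          ≤⟨ m∸n≤m (m + q) p ⟩
      m + q              ≡⟨ +-comm m q ⟩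
      q + m              ≤⟨ +-monoʳ-≤ q (m≤m*n m (suc q)) ⟩
      q + m * suc q      ∎
      where open ≤-Reasoning

  module _ (s : ℕ) .{{_ : NonZero s}} (D : Dictionary s) (q : ℕ) .{{_ : NonZero q}}
           (n : ℕ) .{{_ : NonZero n}} where
    open TotalCost s D q

    sᵏ≢0 : ∀ k → NonZero (s ^ k)
    sᵏ≢0 k = m^n≢0 s k

    instance
      sⁿ≢0 : NonZero (s ^ n)
      sⁿ≢0 = sᵏ≢0 n

      q*sⁿ≢0 : NonZero (q * s ^ n)
      q*sⁿ≢0 = m*n≢0 q (s ^ n)

      n*sⁿ≢0 : NonZero (n * s ^ n)
      n*sⁿ≢0 = m*n≢0 n (s ^ n)

    power-ratio : ∀ x d → d ≤ n → toℚᵘ (frac x (s ^ d) {{sᵏ≢0 d}}) ≃ ratio (x * s ^ (n ∸ d)) (s ^ n)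
    power-ratio x d d≤n = UP.≃-trans (frac-ratio x (s ^ d) {{sᵏ≢0 d}})
                                     (ratio-≃ x (s ^ d) (x * s ^ (n ∸ d)) (s ^ n) {{sᵏ≢0 d}} rescale)
      where
      rescale : x * s ^ n ≡ x * s ^ (n ∸ d) * s ^ d
      rescale = trans (cong (λ k → x * s ^ k) (sym (m∸n+n≡m d≤n)))
                      (trans (cong (x *_) (^-distribˡ-+-* s (n ∸ d) d)) (sym (*-assoc x _ _)))

    boundTerm : ℕ → ℚ.ℚ
    boundTerm m = frac (content D m) 1 ℚ.* sumℚ q (λ p → frac (m ∸ dlen m q p) (s ^ dlen m q p) {{sᵏ≢0 (dlen m q p)}})

    boundTerm-ratio : ∀ m → m ≤ n → toℚᵘ (boundTerm m) ≃ ratio (content D m * weightedCost n m) (s ^ n)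
    boundTerm-ratio m m≤n =
      begin
        toℚᵘ (boundTerm m)
      ≈⟨ toℚᵘ-homo-* (frac (content D m) 1) _ ⟩
        toℚᵘ (frac (content D m) 1) U.* toℚᵘ (sumℚ q (λ p → frac (m ∸ dlen m q p) (s ^ dlen m q p) {{sᵏ≢0 (dlen m q p)}}))
      ≈⟨ UP.*-cong (frac-ratio (content D m) 1)
           (sum-ratio _ (λ p → (m ∸ dlen m q p) * s ^ (n ∸ dlen m q p)) (s ^ n) (upTo q)
             (All.universal (λ p → power-ratio (m ∸ dlen m q p) (dlen m q p) (≤-trans (dlen-≤ m q p) m≤n)) (upTo q))) ⟩
        ratio (content D m) 1 U.* ratio (weightedCost n m) (s ^ n)
      ≈⟨ UP.≃-trans (ratio-* (content D m) 1 (weightedCost n m) (s ^ n))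
                    (ratio-≃ _ (1 * s ^ n) _ (s ^ n) {{m*n≢0 1 (s ^ n)}} (cong (content D m * weightedCost n m *_) (sym (*-identityˡ (s ^ n))))) ⟩
        ratio (content D m * weightedCost n m) (s ^ n)
      ∎
      where open UP.≃-Reasoning

    boundFG-ratio : toℚᵘ (boundFG D q n) ≃ ratio (s ^ n + C n) (q * s ^ n)
    boundFG-ratio =
      begin
        toℚᵘ (boundFG D q n)
      ≈⟨ UP.≃-trans (toℚᵘ-homo-* (frac 1 q) _)
                    (UP.*-cong (frac-ratio 1 q) (toℚᵘ-homo-+ (frac 1 1) (sumℚ (suc n) boundTerm))) ⟩
        ratio 1 q U.* (toℚᵘ (frac 1 1) U.+ toℚᵘ (sumℚ (suc n) boundTerm))
      ≈⟨ UP.*-congˡ {ratio 1 q} (UP.+-cong (frac-ratio 1 1)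
           (sum-ratio boundTerm (λ m → content D m * weightedCost n m) (s ^ n) (upTo (suc n))
             (AllP.applyUpTo⁺₁ id (suc n) (λ {m} m<1+n → boundTerm-ratio m (≤-pred m<1+n))))) ⟩
        ratio 1 q U.* (ratio 1 1 U.+ ratio (C n) (s ^ n))
      ≈⟨ UP.*-congˡ {ratio 1 q} (UP.≃-trans (ratio-+ 1 1 (C n) (s ^ n))
           (ratio-≃ _ (1 * s ^ n) (s ^ n + C n) (s ^ n) {{m*n≢0 1 (s ^ n)}} (one-plus (s ^ n) (C n)))) ⟩
        ratio 1 q U.* ratio (s ^ n + C n) (s ^ n)
      ≈⟨ UP.≃-trans (ratio-* 1 q (s ^ n + C n) (s ^ n))
           (ratio-≃ _ (q * s ^ n) (s ^ n + C n) (q * s ^ n) (cong (_* (q * s ^ n)) (*-identityˡ (s ^ n + C n)))) ⟩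
        ratio (s ^ n + C n) (q * s ^ n)
      ∎
      where
      open UP.≃-Reasoning
      one-plus : ∀ a b → (1 * a + b * 1) * a ≡ (a + b) * (1 * a)
      one-plus = solve-∀

    -- The ℕ bound on the total cost, cross-multiplied, using ⌊n/q⌋ q ≤ n.
    totalCost-cross : totalCostFG D q n * (q * s ^ n) ≤ (s ^ n + C n) * (n * s ^ n)
    totalCost-cross =
      begin
        totalCostFG D q n * (q * s ^ n)
      ≡⟨ sym (*-assoc (totalCostFG D q n) q (s ^ n)) ⟩
        totalCostFG D q n * q * s ^ n
      ≤⟨ *-monoˡ-≤ (s ^ n) (*-monoˡ-≤ q (totalCost-bound n)) ⟩
        (s ^ n * (n / q) + (n / q) * C n) * q * s ^ n
      ≡⟨ regroup (s ^ n) (n / q) (C n) q ⟩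
        (s ^ n + C n) * (n / q * q) * s ^ n
      ≤⟨ *-monoˡ-≤ (s ^ n) (*-monoʳ-≤ (s ^ n + C n) (m/n*n≤m n q)) ⟩
        (s ^ n + C n) * n * s ^ n
      ≡⟨ *-assoc (s ^ n + C n) n (s ^ n) ⟩
        (s ^ n + C n) * (n * s ^ n)
      ∎
      where
      open ≤-Reasoning
      regroup : ∀ a k c q → (a * k + k * c) * q * a ≡ (a + c) * (k * q) * a
      regroup = solve-∀

    avgCost≤boundFG : avgCostFG D q n ℚ.≤ boundFG D q n
    avgCost≤boundFG = toℚᵘ-cancel-≤ (
      begin
        toℚᵘ (avgCostFG D q n)
      ≃⟨ frac-ratio (totalCostFG D q n) (n * s ^ n) ⟩
        ratio (totalCostFG D q n) (n * s ^ n)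
      ≤⟨ ratio-≤ (totalCostFG D q n) (n * s ^ n) (s ^ n + C n) (q * s ^ n) totalCost-cross ⟩
        ratio (s ^ n + C n) (q * s ^ n)
      ≃⟨ UP.≃-sym boundFG-ratio ⟩
        toℚᵘ (boundFG D q n)
      ∎)
      where open UP.≤-Reasoning

open import Defs
open import Data.Nat using (ℕ; NonZero)
open import Data.List using ([])
open import Data.Bool using (false)
open import Data.Product using (∃-syntax; _,_)
open import Data.Rational using (ℚ; 0ℚ; _+_; _≤_; _<_)
open import Data.Rational.Properties using (≤-trans; <⇒≤; +-monoʳ-≤; +-identityʳ)
open import Relation.Binary.PropositionalEquality using (_≡_; subst)

-- Since the bound holds for every n with M = n, the threshold N = 0 works.
proposition1 : (s : ℕ) .{{_ : NonZero s}} (D : Dictionary s) → D [] ≡ false →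
    (q : ℕ) .{{_ : NonZero q}} →
    (ε : ℚ) → 0ℚ < ε →
    ∃[ N ] ((n : ℕ) .{{_ : NonZero n}} → N Data.Nat.≤ n →
    ∃[ M ] (avgCostFG D q n ≤ boundFG D q M + ε))
proposition1 s D _ q ε ε>0 = 0 , λ n _ → n , ≤-trans (AverageCost.avgCost≤boundFG s D q n) bound≤bound+ε
  where
  bound≤bound+ε : ∀ {b} → b ≤ b + ε
  bound≤bound+ε {b} = subst (_≤ b + ε) (+-identityʳ b) (+-monoʳ-≤ b (<⇒≤ ε>0))
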